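{- Let $n \geq 2$ be an even integer and $p$ a prime. If $\frac{n+1}{3} < p < \frac{n+1}{2}$, then $s_p(n) < p$.
   Context: $s_p(n)$ denotes the sum of the digits of $n$ in base $p$. -}

module Defs where

open import Data.Nat using (ℕ; zero; suc; _+_; _≤_; NonZero)
open import Data.Nat.DivMod using (_/_; _%_)

-- Sum of base-p digits with fuel: digitSumFuel k p n computes s_p(n)
-- correctly whenever k ≥ number of base-p digits of n (e.g. k ≥ n, p ≥ 2).
digitSumFuel : ℕ → (p : ℕ) → .{{NonZero p}} → ℕ → ℕ
digitSumFuel zero    p n       = 0
digitSumFuel (suc k) p zero    = 0
digitSumFuel (suc k) p (suc m) = (suc m % p) + digitSumFuel k p (suc m / p)

-- s_p(n): the sum of the digits of n in base p (meaningful for p ≥ 2;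
-- n itself is sufficient fuel since n has at most n base-p digits).
s : (p : ℕ) → .{{NonZero p}} → ℕ → ℕ
s p n = digitSumFuel n p n

module Submission where

-- Write n = r + 2p.  The window (n+1)/3 < p < (n+1)/2 says
-- exactly 2p ≤ n and n + 2 ≤ 3p, i.e. r + 2 ≤ p.  Since n and 2p are
-- even, so is r + 2; for an odd prime p this forces r + 2 < p, so in
-- particular r < p and 2 < p, and n has the two base-p digits r and 2.
-- Hence s_p(n) = r + 2 < p.  The prime p = 2 is handled separately: the
-- window then pins n = 4, and s_2(4) = 1 < 2 by computation.

open import Defs
open import Data.Nat using (ℕ; _+_; _*_; _≤_; _<_; NonZero)
open import Data.Nat.Primality using (Prime)
open import Data.Nat.Divisibility using (_∣_)
open import Data.Nat.Base using (zero; suc; _∸_; z≤n; s≤s)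
open import Data.Nat.Properties
open import Data.Nat.DivMod
  using (_/_; _%_; [m+kn]%n≡m%n; m<n⇒m%n≡m; m<n⇒m/n≡0; m*n/n≡m; +-distrib-/-∣ʳ)
open import Data.Nat.Divisibility using (n∣m*n; m∣m*n; ∣m+n∣m⇒∣n; ∣m∣n⇒∣m+n; ∣-refl)
open import Data.Nat.Primality using (prime⇒irreducible)
open import Relation.Binary.PropositionalEquality
open import Data.Sum using (inj₁; inj₂)
open import Relation.Nullary using (contradiction)

digitSumFuel-zero : ∀ f p .{{_ : NonZero p}} → digitSumFuel f p 0 ≡ 0
digitSumFuel-zero zero    p = refl
digitSumFuel-zero (suc f) p = refl

digitSumFuel-step : ∀ f p .{{_ : NonZero p}} x → 0 < x →
  digitSumFuel (suc f) p x ≡ x % p + digitSumFuel f p (x / p)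
digitSumFuel-step f p (suc m) _ = refl

digitSumFuel-digit : ∀ f p .{{_ : NonZero p}} d → d < p →
  digitSumFuel (suc f) p d ≡ d
digitSumFuel-digit f p zero    _   = refl
digitSumFuel-digit f p (suc m) d<p = begin
    digitSumFuel (suc f) p d
  ≡⟨ digitSumFuel-step f p d (s≤s z≤n) ⟩
    d % p + digitSumFuel f p (d / p)
  ≡⟨ cong₂ _+_ (m<n⇒m%n≡m d<p) (cong (digitSumFuel f p) (m<n⇒m/n≡0 d<p)) ⟩
    d + digitSumFuel f p 0
  ≡⟨ cong (d +_) (digitSumFuel-zero f p) ⟩
    d + 0
  ≡⟨ +-identityʳ d ⟩
    d
  ∎
  where
  open ≡-Reasoning
  d = suc m

digitSumFuel-twoDigits : ∀ f p .{{_ : NonZero p}} r d → r < p → d < p → 0 < d →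
  digitSumFuel (suc (suc f)) p (r + d * p) ≡ r + d
digitSumFuel-twoDigits f p r d r<p d<p 0<d = begin
    digitSumFuel (suc (suc f)) p x
  ≡⟨ digitSumFuel-step (suc f) p x 0<x ⟩
    x % p + digitSumFuel (suc f) p (x / p)
  ≡⟨ cong₂ _+_ lowDigit (cong (digitSumFuel (suc f) p) highDigit) ⟩
    r + digitSumFuel (suc f) p d
  ≡⟨ cong (r +_) (digitSumFuel-digit f p d d<p) ⟩
    r + d
  ∎
  where
  open ≡-Reasoning
  x = r + d * p
  0<x : 0 < x
  0<x = <-≤-trans 0<d (≤-trans (m≤m*n d p) (m≤n+m (d * p) r))
  lowDigit : x % p ≡ r
  lowDigit = trans ([m+kn]%n≡m%n r d p) (m<n⇒m%n≡m r<p)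
  highDigit : x / p ≡ d
  highDigit = trans (+-distrib-/-∣ʳ r (n∣m*n d))
                    (cong₂ _+_ (m<n⇒m/n≡0 r<p) (m*n/n≡m d p))

excess-bound : ∀ {n k c m} → k ≤ n → n + c ≤ k + m → (n ∸ k) + c ≤ m
excess-bound {n} {k} {c} {m} k≤n n+c≤k+m = +-cancelˡ-≤ k ((n ∸ k) + c) m
  (subst (_≤ k + m) (sym k+[[n∸k]+c]≡n+c) n+c≤k+m)
  where
  k+[[n∸k]+c]≡n+c : k + ((n ∸ k) + c) ≡ n + c
  k+[[n∸k]+c]≡n+c = trans (sym (+-assoc k (n ∸ k) c)) (cong (_+ c) (m+[n∸m]≡n k≤n))

even-prime≡2 : ∀ {p} → Prime p → 2 ∣ p → p ≡ 2
even-prime≡2 pp 2∣p with prime⇒irreducible pp 2∣p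
... | inj₁ ()
... | inj₂ 2≡p = sym 2≡p

even≤oddPrime⇒< : ∀ {m p} → Prime p → p ≢ 2 → 2 ∣ m → m ≤ p → m < p
even≤oddPrime⇒< pp p≢2 2∣m m≤p with m≤n⇒m<n∨m≡n m≤p
... | inj₁ m<p = m<p
... | inj₂ m≡p = contradiction (even-prime≡2 pp (subst (2 ∣_) m≡p 2∣m)) p≢2

lemma2 : (n p : ℕ) → 2 ≤ n → 2 ∣ n → (pp : Prime p) → .{{_ : NonZero p}}
    → n + 1 < 3 * p → 2 * p < n + 1 → s p n < p
lemma2 n 2 _ _ _ n+1<6 4<n+1 = subst (λ m → s 2 m < 2) (sym n≡4) (s≤s (s≤s z≤n))
  where
  -- s_2(4) = 1 is checked by evaluation once n is pinned to 4.
  n≡4 : n ≡ 4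
  n≡4 = ≤-antisym (m<1+n⇒m≤n (m<1+n⇒m≤n (subst (_< 6) (+-comm n 1) n+1<6)))
                  (m<1+n⇒m≤n (subst (4 <_) (+-comm n 1) 4<n+1))
lemma2 n@(suc (suc f)) p@(suc (suc (suc _))) (s≤s (s≤s _)) 2∣n pp n+1<3p 2p<n+1 =
  subst (_< p) (sym sₚn≡r+2) r+2<p
  where
  2p≤n : 2 * p ≤ n
  2p≤n = m<1+n⇒m≤n (subst (2 * p <_) (+-comm n 1) 2p<n+1)
  r = n ∸ 2 * p
  n≡r+2p : n ≡ r + 2 * p
  n≡r+2p = sym (m∸n+n≡m 2p≤n)
  r+2≤p : r + 2 ≤ p
  r+2≤p = excess-bound 2p≤n (subst₂ _≤_ (sym (+-suc n 1)) 3p≡2p+p n+1<3p)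
    where
    3p≡2p+p : 3 * p ≡ 2 * p + p
    3p≡2p+p = trans (*-distribʳ-+ p 2 1) (cong (2 * p +_) (*-identityˡ p))
  -- r + 2 = n - 2(p - 1) is even, hence below the odd prime p
  2∣r+2 : 2 ∣ r + 2
  2∣r+2 = ∣m∣n⇒∣m+n (∣m+n∣m⇒∣n (subst (2 ∣_) (trans n≡r+2p (+-comm r (2 * p))) 2∣n)
                                (m∣m*n p)) ∣-refl
  r+2<p : r + 2 < p
  r+2<p = even≤oddPrime⇒< pp (λ ()) 2∣r+2 r+2≤p
  sₚn≡r+2 : s p n ≡ r + 2
  sₚn≡r+2 = trans (cong (digitSumFuel n p) n≡r+2p)
    (digitSumFuel-twoDigits f p r 2 (<-trans (m<m+n r (s≤s z≤n)) r+2<p)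
                                    (≤-<-trans (m≤n+m 2 r) r+2<p) (s≤s z≤n))
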